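{- Let $r \geq 4$ and let $n \geq 2(r-1)$ be even. Let $H$ be any $(r-3)$-regular bipartite graph with parts $A$ and $B$, each of size $n/2$, that contains no cycle of length $4$. Let $G$ be the graph on vertex set $A \cup B$ whose edges are the edges of $H$ together with all pairs of distinct vertices in $A$ and all pairs of distinct vertices in $B$ (so $A$ and $B$ each induce a clique). Then $\delta(G) = n/2 + (r-4)$ and $m(G, r) > r$.
   Context: Graphs are finite and simple; $\delta(G)$ is the minimum degree and $N(v)$ the neighbourhood of $v$. For an integer $r \geq 2$, the $r$-neighbour bootstrap process on $G$ started from $X \subseteq V(G)$ is defined by $X_0 = X$ and $X_t = X_{t-1} \cup \{v \in V(G) : |N(v) \cap X_{t-1}| \geq r\}$ for $t \geq 1$. The closure is $\langle X \rangle_r = \bigcup_{t \geq 0} X_t$. The set $X$ percolates if $\langle X \rangle_r = V(G)$. Define $m(G,r) = \min\{|X| : X \subseteq V(G),\ \langle X \rangle_r = V(G)\}$. -}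

module Defs where

open import Data.Nat using (ℕ; zero; suc; _+_; _≤_; _≤ᵇ_)
open import Data.Bool using (Bool; true; false; _∧_; _∨_; not; if_then_else_)
open import Data.Fin using (Fin; zero; suc; splitAt)
open import Data.Fin.Properties using (_≟_)
open import Data.Sum using (_⊎_; inj₁; inj₂)
open import Data.Product using (_×_; Σ; ∃; _,_)
open import Relation.Nullary using (¬_; yes; no)
open import Relation.Nullary.Decidable using (⌊_⌋)
open import Relation.Binary.PropositionalEquality using (_≡_; refl)

countTrue : ∀ {N} → (Fin N → Bool) → ℕ
countTrue {zero}  f = 0
countTrue {suc N} f = (if f zero then 1 else 0) + countTrue (λ i → f (suc i))

record Graph (N : ℕ) : Set where
  field
    adj    : Fin N → Fin N → Bool
    sym    : ∀ u v → adj u v ≡ adj v u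
    irrefl : ∀ v → adj v v ≡ false
open Graph public

VSet : ℕ → Set
VSet N = Fin N → Bool

∣_∣ˢ : ∀ {N} → VSet N → ℕ
∣ X ∣ˢ = countTrue X

deg : ∀ {N} → Graph N → Fin N → ℕ
deg G v = countTrue (adj G v)

IsMinDegree : ∀ {N} → Graph N → ℕ → Set
IsMinDegree G d = (∀ v → d ≤ deg G v) × (∃ λ v → deg G v ≡ d)

step : ∀ {N} → Graph N → ℕ → VSet N → VSet N
step G r X v = X v ∨ (r ≤ᵇ countTrue (λ u → adj G v u ∧ X u))

bootstrap : ∀ {N} → Graph N → ℕ → VSet N → ℕ → VSet N
bootstrap G r X zero    = X
bootstrap G r X (suc t) = step G r (bootstrap G r X t)

InClosure : ∀ {N} → Graph N → ℕ → VSet N → Fin N → Set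
InClosure G r X v = ∃ λ t → bootstrap G r X t v ≡ true

Percolates : ∀ {N} → Graph N → ℕ → VSet N → Set
Percolates G r X = ∀ v → InClosure G r X v

mGreaterThan : ∀ {N} → Graph N → ℕ → ℕ → Set
mGreaterThan G r s = ∀ X → Percolates G r X → suc s ≤ ∣ X ∣ˢ

-- Bipartite graph H between parts A = Fin k and B = Fin k, given by hE a b.
-- degree of a ∈ A, and of b ∈ B
degA : ∀ {k} → (Fin k → Fin k → Bool) → Fin k → ℕ
degA hE a = countTrue (hE a)

degB : ∀ {k} → (Fin k → Fin k → Bool) → Fin k → ℕ
degB hE b = countTrue (λ a → hE a b)

IsRegularBip : ∀ {k} → (Fin k → Fin k → Bool) → ℕ → Set
IsRegularBip hE d = (∀ a → degA hE a ≡ d) × (∀ b → degB hE b ≡ d)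

C4Free : ∀ {k} → (Fin k → Fin k → Bool) → Set
C4Free {k} hE = ∀ (a a' b b' : Fin k) → ¬ (a ≡ a') → ¬ (b ≡ b') →
  ¬ ((hE a b ≡ true) × (hE a b' ≡ true) × (hE a' b ≡ true) × (hE a' b' ≡ true))

-- Vertex set A ∪ B = Fin (k + k): the first k vertices are A, the last k are B.
neq : ∀ {k} → Fin k → Fin k → Bool
neq a b = not ⌊ a ≟ b ⌋

cliqueAdj : ∀ {k} → (Fin k → Fin k → Bool) → Fin (k + k) → Fin (k + k) → Bool
cliqueAdj {k} hE u v with splitAt k u | splitAt k v
... | inj₁ a | inj₁ a' = neq a a'
... | inj₂ b | inj₂ b' = neq b b'
... | inj₁ a | inj₂ b  = hE a b
... | inj₂ b | inj₁ a  = hE a b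

private
  neq-sym : ∀ {k} (a b : Fin k) → neq a b ≡ neq b a
  neq-sym a b with a ≟ b | b ≟ a
  ... | yes _ | yes _ = refl
  ... | no _  | no _  = refl
  ... | yes refl | no ¬p = Data.Empty.⊥-elim (¬p refl)
    where import Data.Empty
  ... | no ¬p | yes refl = Data.Empty.⊥-elim (¬p refl)
    where import Data.Empty

  neq-irr : ∀ {k} (a : Fin k) → neq a a ≡ false
  neq-irr a with a ≟ a
  ... | yes _ = refl
  ... | no ¬p = Data.Empty.⊥-elim (¬p refl)
    where import Data.Empty

  cl-sym : ∀ {k} (hE : Fin k → Fin k → Bool) u v → cliqueAdj hE u v ≡ cliqueAdj hE v u
  cl-sym {k} hE u v with splitAt k u | splitAt k v
  ... | inj₁ a | inj₁ a' = neq-sym a a'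
  ... | inj₂ b | inj₂ b' = neq-sym b b'
  ... | inj₁ a | inj₂ b  = refl
  ... | inj₂ b | inj₁ a  = refl

  cl-irr : ∀ {k} (hE : Fin k → Fin k → Bool) v → cliqueAdj hE v v ≡ false
  cl-irr {k} hE v with splitAt k v
  ... | inj₁ a = neq-irr a
  ... | inj₂ b = neq-irr b

cliqueGraph : ∀ {k} → (Fin k → Fin k → Bool) → Graph (k + k)
cliqueGraph hE = record { adj = cliqueAdj hE ; sym = cl-sym hE ; irrefl = cl-irr hE }

-- Each vertex has n/2 − 1 neighbours in its own clique and r − 3 in H, so G is
-- (n/2 + r − 4)-regular.
--
-- Call S closed if every vertex outside S has fewer than r neighbours in S; the
-- r-neighbour process started inside a closed set never leaves it, so it
-- suffices to put every X with |X| ≤ r into a proper closed set. Let d = r − 3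
-- be the degree of H. A vertex of A outside S has |S ∩ A| clique neighbours in
-- S and at most d more through H. If |X ∩ B| ≤ 2, then A ∪ (X ∩ B) is closed.
-- Otherwise both parts of X have between 3 and d vertices, and a vertex of A can
-- only become infected if it is H-adjacent to all of X ∩ B; by C4-freeness any
-- other vertex of A then has at most one H-neighbour in X ∩ B. Adding such a
-- vertex p, and possibly one vertex q of B adjacent to all but at most one
-- vertex of (X ∩ A) ∪ {p}, already gives a closed set.
module Submission where

open import Defs hiding (sym)
open import Data.Bool using (Bool; true; false; _∧_; _∨_; not; T)
open import Data.Bool.Properties
  using (∧-conicalˡ; ∧-conicalʳ; ∨-conicalʳ; ∨-zeroʳ; ∧-identityʳ; ∧-zeroʳ; ∧-comm)
  renaming (_≟_ to _≟ᵇ_)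
open import Data.Empty using (⊥-elim)
open import Data.Fin using (Fin; zero; suc; _↑ˡ_; _↑ʳ_; splitAt; fromℕ<)
open import Data.Fin.Properties
  using (_≟_; any?; suc-injective; splitAt-↑ˡ; splitAt-↑ʳ; splitAt⁻¹-↑ˡ; splitAt⁻¹-↑ʳ)
open import Data.Nat using (ℕ; zero; suc; _+_; _*_; _∸_; _≤_; _<_; z≤n; s≤s; s≤s⁻¹; _≤?_)
open import Data.Nat.Properties hiding (_≟_; suc-injective)
open import Data.Product using (_×_; ∃; _,_; proj₁; proj₂)
open import Data.Sum using (_⊎_; inj₁; inj₂; [_,_]′) renaming (swap to ⊎-swap)
open import Data.Unit using (tt)
open import Function using (flip; _∘_)
open import Relation.Nullary using (¬_; yes; no; Dec)
open import Relation.Nullary.Decidable using (⌊_⌋; _×-dec_)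
open import Relation.Binary.PropositionalEquality
  using (_≡_; _≢_; refl; sym; trans; cong; cong₂; subst; module ≡-Reasoning)

infix  4 _∈ˢ_ _∉ˢ_ _⊆_
infixr 7 _∩_
infixr 6 _∪_

_∈ˢ_ _∉ˢ_ : ∀ {N} → Fin N → VSet N → Set
i ∈ˢ X = X i ≡ true
i ∉ˢ X = X i ≡ false

_⊆_ : ∀ {N} → VSet N → VSet N → Set
X ⊆ Y = ∀ i → i ∈ˢ X → i ∈ˢ Y

_∩_ _∪_ : ∀ {N} → VSet N → VSet N → VSet N
(X ∩ Y) i = X i ∧ Y i
(X ∪ Y) i = X i ∨ Y i

∁ : ∀ {N} → VSet N → VSet N
∁ X i = not (X i)

｛_｝ : ∀ {N} → Fin N → VSet N
｛ p ｝ i = ⌊ p ≟ i ⌋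

full : ∀ {N} → VSet N
full _ = true

module _ {N : ℕ} {X Y : VSet N} where

  ∩-⊆ˡ : X ∩ Y ⊆ X
  ∩-⊆ˡ i = ∧-conicalˡ (X i) (Y i)

  ∩-⊆ʳ : X ∩ Y ⊆ Y
  ∩-⊆ʳ i = ∧-conicalʳ (X i) (Y i)

  ∈-∩ : ∀ i → i ∈ˢ X → i ∈ˢ Y → i ∈ˢ X ∩ Y
  ∈-∩ i i∈X i∈Y rewrite i∈X | i∈Y = refl

  ∉-∩ˡ : ∀ i → i ∉ˢ X → i ∉ˢ X ∩ Y
  ∉-∩ˡ i i∉X rewrite i∉X = refl

  ∉-∩ʳ : ∀ i → i ∉ˢ Y → i ∉ˢ X ∩ Y
  ∉-∩ʳ i i∉Y rewrite i∉Y = ∧-zeroʳ (X i)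

  ⊆-∪ˡ : X ⊆ X ∪ Y
  ⊆-∪ˡ i i∈X rewrite i∈X = refl

∩-monoʳ : ∀ {N} {X Y Z : VSet N} → Y ⊆ Z → X ∩ Y ⊆ X ∩ Z
∩-monoʳ {X = X} {Y} {Z} Y⊆Z i i∈X∩Y =
  ∈-∩ {X = X} {Z} i (∩-⊆ˡ {X = X} {Y} i i∈X∩Y) (Y⊆Z i (∩-⊆ʳ {X = X} {Y} i i∈X∩Y))

∈｛｝ : ∀ {N} (p : Fin N) → p ∈ˢ ｛ p ｝
∈｛｝ p with p ≟ p
... | yes _   = refl
... | no p≢p = ⊥-elim (p≢p refl)

｛suc｝ : ∀ {N} (p i : Fin N) → ｛ suc p ｝ (suc i) ≡ ｛ p ｝ i
｛suc｝ p i with p ≟ i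
... | yes _ = refl
... | no _  = refl

∉∪｛｝⇒≢ : ∀ {N} {X : VSet N} {p} i → i ∉ˢ X ∪ ｛ p ｝ → i ≢ p
∉∪｛｝⇒≢ {X = X} {p} i i∉ refl with () ← trans (sym (∨-conicalʳ (X p) _ i∉)) (∈｛｝ p)

∣∣-mono : ∀ {N} {X Y : VSet N} → X ⊆ Y → ∣ X ∣ˢ ≤ ∣ Y ∣ˢ
∣∣-mono {zero}  _ = z≤n
∣∣-mono {suc N} {X} {Y} X⊆Y with X zero in x₀ | Y zero in y₀
... | true  | true  = s≤s (∣∣-mono {N} {X ∘ suc} {Y ∘ suc} (X⊆Y ∘ suc))
... | false | true  = m≤n⇒m≤1+n (∣∣-mono {N} {X ∘ suc} {Y ∘ suc} (X⊆Y ∘ suc))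
... | false | false = ∣∣-mono {N} {X ∘ suc} {Y ∘ suc} (X⊆Y ∘ suc)
... | true  | false with () ← trans (sym y₀) (X⊆Y zero x₀)

∣∣-cong : ∀ {N} {X Y : VSet N} → (∀ i → X i ≡ Y i) → ∣ X ∣ˢ ≡ ∣ Y ∣ˢ
∣∣-cong X≗Y = ≤-antisym (∣∣-mono λ i e → trans (sym (X≗Y i)) e) (∣∣-mono λ i e → trans (X≗Y i) e)

∣∣-split : ∀ {N} (X Y : VSet N) → ∣ X ∣ˢ ≡ ∣ X ∩ Y ∣ˢ + ∣ X ∩ ∁ Y ∣ˢ
∣∣-split {zero}  X Y = refl
∣∣-split {suc N} X Y with X zero | Y zero
... | true  | true  = cong suc (∣∣-split (X ∘ suc) (Y ∘ suc))
... | true  | false = trans (cong suc (∣∣-split (X ∘ suc) (Y ∘ suc))) (sym (+-suc _ _))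
... | false | _     = ∣∣-split (X ∘ suc) (Y ∘ suc)

∣∪∣≤ : ∀ {N} (X Y : VSet N) → ∣ X ∪ Y ∣ˢ ≤ ∣ X ∣ˢ + ∣ Y ∣ˢ
∣∪∣≤ {zero}  X Y = z≤n
∣∪∣≤ {suc N} X Y with X zero | Y zero
... | true  | true  = s≤s (≤-trans (∣∪∣≤ (X ∘ suc) (Y ∘ suc)) (≤-trans (n≤1+n _) (≤-reflexive (sym (+-suc _ _)))))
... | true  | false = s≤s (∣∪∣≤ (X ∘ suc) (Y ∘ suc))
... | false | true  = ≤-trans (s≤s (∣∪∣≤ (X ∘ suc) (Y ∘ suc))) (≤-reflexive (sym (+-suc _ _)))
... | false | false = ∣∪∣≤ (X ∘ suc) (Y ∘ suc)

∣∣<N⇒∉ : ∀ {N} (X : VSet N) → ∣ X ∣ˢ < N → ∃ (_∉ˢ X)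
∣∣<N⇒∉ {suc N} X ∣X∣<N with X zero in x₀
... | false = zero , x₀
... | true  with ∣∣<N⇒∉ (X ∘ suc) (s≤s⁻¹ ∣X∣<N)
...   | i , i∉X = suc i , i∉X

∈⇒∣∣>0 : ∀ {N} (X : VSet N) i → i ∈ˢ X → 0 < ∣ X ∣ˢ
∈⇒∣∣>0 X zero    i∈X rewrite i∈X = s≤s z≤n
∈⇒∣∣>0 X (suc i) i∈X with X zero
... | true  = s≤s z≤n
... | false = ∈⇒∣∣>0 (X ∘ suc) i i∈X

∣∣>0⇒∈ : ∀ {N} (X : VSet N) → 0 < ∣ X ∣ˢ → ∃ (_∈ˢ X)
∣∣>0⇒∈ {suc N} X ∣X∣>0 with X zero in x₀
... | true  = zero , x₀
... | false with ∣∣>0⇒∈ (X ∘ suc) ∣X∣>0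
...   | i , i∈X = suc i , i∈X

∣∣≥2⇒distinct : ∀ {N} (X : VSet N) → 2 ≤ ∣ X ∣ˢ → ∃ λ i → ∃ λ j → i ≢ j × i ∈ˢ X × j ∈ˢ X
∣∣≥2⇒distinct {suc N} X ∣X∣≥2 with X zero in x₀
... | true with ∣∣>0⇒∈ (X ∘ suc) (s≤s⁻¹ ∣X∣≥2)
...   | j , j∈X = zero , suc j , (λ ()) , x₀ , j∈X
∣∣≥2⇒distinct {suc N} X ∣X∣≥2 | false with ∣∣≥2⇒distinct (X ∘ suc) ∣X∣≥2
...   | i , j , i≢j , i∈X , j∈X = suc i , suc j , i≢j ∘ suc-injective , i∈X , j∈X

∣∣-strict : ∀ {N} {X Y : VSet N} → X ⊆ Y → ∀ i → i ∉ˢ X → i ∈ˢ Y → ∣ X ∣ˢ < ∣ Y ∣ˢ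
∣∣-strict {X = X} {Y} X⊆Y i i∉X i∈Y = begin-strict
  ∣ X ∣ˢ                          ≤⟨ ∣∣-mono (λ j j∈X → ∈-∩ {X = Y} {X} j (X⊆Y j j∈X) j∈X) ⟩
  ∣ Y ∩ X ∣ˢ                      <⟨ m<m+n _ (∈⇒∣∣>0 (Y ∩ ∁ X) i (∈-∩ {X = Y} {∁ X} i i∈Y (cong not i∉X))) ⟩
  ∣ Y ∩ X ∣ˢ + ∣ Y ∩ ∁ X ∣ˢ       ≡⟨ sym (∣∣-split Y X) ⟩
  ∣ Y ∣ˢ                          ∎
  where open ≤-Reasoning

∣∩∣<∣∣ : ∀ {N} {X Y : VSet N} j → j ∈ˢ X → j ∉ˢ Y → ∣ X ∩ Y ∣ˢ < ∣ X ∣ˢ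
∣∩∣<∣∣ {X = X} {Y} j j∈X j∉Y = ∣∣-strict ∩-⊆ˡ j (∉-∩ʳ {X = X} {Y} j j∉Y) j∈X

∣∣≤∣∩∣⇒⊆ : ∀ {N} {X Y : VSet N} → ∣ X ∣ˢ ≤ ∣ Y ∩ X ∣ˢ → X ⊆ Y
∣∣≤∣∩∣⇒⊆ {X = X} {Y} ∣X∣≤ i i∈X with Y i in y
... | true  = refl
... | false = ⊥-elim (<⇒≱ (∣∣-strict ∩-⊆ʳ i (∉-∩ˡ {X = Y} {X} i y) i∈X) ∣X∣≤)

∣｛_｝∣ : ∀ {N} (p : Fin N) → ∣ ｛ p ｝ ∣ˢ ≡ 1
∣｛_｝∣ {suc N} zero = cong suc (∣∅∣ N)
  where
    ∣∅∣ : ∀ M → ∣ (λ (i : Fin M) → false) ∣ˢ ≡ 0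
    ∣∅∣ zero    = refl
    ∣∅∣ (suc M) = ∣∅∣ M
∣｛_｝∣ {suc N} (suc p) = trans (∣∣-cong (｛suc｝ p)) ∣｛ p ｝∣

∣∪｛｝∣ : ∀ {N} (X : VSet N) {p} → p ∉ˢ X → ∣ X ∪ ｛ p ｝ ∣ˢ ≡ suc ∣ X ∣ˢ
∣∪｛｝∣ X {p} p∉X = ≤-antisym
  (≤-trans (∣∪∣≤ X ｛ p ｝) (≤-reflexive (trans (cong (∣ X ∣ˢ +_) ∣｛ p ｝∣) (+-comm _ 1))))
  (∣∣-strict ⊆-∪ˡ p p∉X (trans (cong (X p ∨_) (∈｛｝ p)) (∨-zeroʳ (X p))))

∣∩∪｛｝∣≤ : ∀ {N} (X Y : VSet N) q → ∣ X ∩ (Y ∪ ｛ q ｝) ∣ˢ ≤ suc ∣ X ∩ Y ∣ˢ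
∣∩∪｛｝∣≤ X Y q = begin
  ∣ X ∩ (Y ∪ ｛ q ｝) ∣ˢ           ≤⟨ ∣∣-mono (λ i → distrib (X i) (Y i) (｛ q ｝ i)) ⟩
  ∣ (X ∩ Y) ∪ ｛ q ｝ ∣ˢ           ≤⟨ ∣∪∣≤ (X ∩ Y) ｛ q ｝ ⟩
  ∣ X ∩ Y ∣ˢ + ∣ ｛ q ｝ ∣ˢ        ≡⟨ trans (cong (∣ X ∩ Y ∣ˢ +_) ∣｛ q ｝∣) (+-comm _ 1) ⟩
  suc ∣ X ∩ Y ∣ˢ                  ∎
  where
    open ≤-Reasoning
    distrib : ∀ x y z → x ∧ (y ∨ z) ≡ true → (x ∧ y) ∨ z ≡ true
    distrib true  true  z _ = refl
    distrib true  false z e = e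

∣∩∪｛｝∣-∉ : ∀ {N} (X Y : VSet N) {q} → q ∉ˢ X → ∣ X ∩ (Y ∪ ｛ q ｝) ∣ˢ ≤ ∣ X ∩ Y ∣ˢ
∣∩∪｛｝∣-∉ X Y {q} q∉X = ∣∣-mono drop-q
  where
    drop-q : X ∩ (Y ∪ ｛ q ｝) ⊆ X ∩ Y
    drop-q i e with Y i | q ≟ i
    ... | true  | _        = e
    ... | false | no _     = e
    ... | false | yes refl with () ← trans (sym q∉X) (trans (sym (∧-identityʳ (X q))) e)

∣∩∁∣≤1 : ∀ {N} {X Y : VSet N} {m} → ∣ X ∣ˢ ≡ suc m → m ≤ ∣ X ∩ Y ∣ˢ → ∣ X ∩ ∁ Y ∣ˢ ≤ 1
∣∩∁∣≤1 {X = X} {Y} {m} ∣X∣≡ m≤ = +-cancelˡ-≤ m _ 1 (begin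
  m + ∣ X ∩ ∁ Y ∣ˢ                ≤⟨ +-monoˡ-≤ _ m≤ ⟩
  ∣ X ∩ Y ∣ˢ + ∣ X ∩ ∁ Y ∣ˢ       ≡⟨ sym (∣∣-split X Y) ⟩
  ∣ X ∣ˢ                          ≡⟨ trans ∣X∣≡ (+-comm 1 m) ⟩
  m + 1                           ∎)
  where open ≤-Reasoning

∣∩∣-comm : ∀ {N} (X Y : VSet N) → ∣ X ∩ Y ∣ˢ ≡ ∣ Y ∩ X ∣ˢ
∣∩∣-comm X Y = ∣∣-cong (λ i → ∧-comm (X i) (Y i))

∣∩full∣ : ∀ {N} (X : VSet N) → ∣ X ∩ full ∣ˢ ≡ ∣ X ∣ˢ
∣∩full∣ X = ∣∣-cong (λ i → ∧-identityʳ (X i))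

∣∁｛｝∣ : ∀ {N} (i : Fin N) → suc ∣ ∁ ｛ i ｝ ∣ˢ ≡ N
∣∁｛｝∣ {N} i = begin
  suc ∣ ∁ ｛ i ｝ ∣ˢ                  ≡⟨ cong (_+ ∣ ∁ ｛ i ｝ ∣ˢ) (sym ∣｛ i ｝∣) ⟩
  ∣ ｛ i ｝ ∣ˢ + ∣ ∁ ｛ i ｝ ∣ˢ        ≡⟨ sym (∣∣-split full ｛ i ｝) ⟩
  ∣ full {N} ∣ˢ                     ≡⟨ ∣full∣ N ⟩
  N                                 ∎
  where
    open ≡-Reasoning
    ∣full∣ : ∀ M → ∣ full {M} ∣ˢ ≡ M
    ∣full∣ zero    = refl
    ∣full∣ (suc M) = cong suc (∣full∣ M)

∣∣-splitAt : ∀ m n (X : VSet (m + n)) → ∣ X ∣ˢ ≡ ∣ X ∘ (_↑ˡ n) ∣ˢ + ∣ X ∘ (m ↑ʳ_) ∣ˢ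
∣∣-splitAt zero    n X = refl
∣∣-splitAt (suc m) n X with X zero
... | true  = cong suc (∣∣-splitAt m n (X ∘ suc))
... | false = ∣∣-splitAt m n (X ∘ suc)

IsClosed : ∀ {N} → Graph N → ℕ → VSet N → Set
IsClosed G r S = ∀ v → v ∉ˢ S → ∣ adj G v ∩ S ∣ˢ < r

bootstrap⊆closed : ∀ {N} {G : Graph N} {r X S} → X ⊆ S → IsClosed G r S → ∀ t → bootstrap G r X t ⊆ S
bootstrap⊆closed X⊆S S-closed zero = X⊆S
bootstrap⊆closed {G = G} {r} {X} {S} X⊆S S-closed (suc t) v infected
  with S v in v∈S | bootstrap G r X t v in earlier
... | true  | _     = refl
... | false | true  = trans (sym v∈S) (bootstrap⊆closed X⊆S S-closed t v earlier)
... | false | false = ⊥-elim (<⇒≱ (S-closed v v∈S) (begin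
  r                                         ≤⟨ ≤ᵇ⇒≤ r _ (subst T (sym infected) tt) ⟩
  ∣ adj G v ∩ bootstrap G r X t ∣ˢ           ≤⟨ ∣∣-mono (∩-monoʳ {X = adj G v} (bootstrap⊆closed X⊆S S-closed t)) ⟩
  ∣ adj G v ∩ S ∣ˢ                           ∎))
  where open ≤-Reasoning

closed⇒¬percolates : ∀ {N} {G : Graph N} {r X S} → X ⊆ S → IsClosed G r S →
  ∀ v → v ∉ˢ S → ¬ Percolates G r X
closed⇒¬percolates X⊆S S-closed v v∉S percolates with percolates v
... | t , v∈Xₜ with () ← trans (sym v∉S) (bootstrap⊆closed X⊆S S-closed t v v∈Xₜ)

regular⇒IsMinDegree : ∀ {N} {G : Graph N} {D} → (∀ v → deg G v ≡ D) → Fin N → IsMinDegree G D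
regular⇒IsMinDegree deg≡D v = (λ u → ≤-reflexive (sym (deg≡D u))) , v , deg≡D v

m+n≤3+o⇒m≤o : ∀ {m n o} → 3 ≤ n → m + n ≤ 3 + o → m ≤ o
m+n≤3+o⇒m≤o {m} {n} {o} 3≤n m+n≤ =
  +-cancelʳ-≤ 3 m o (≤-trans (+-monoʳ-≤ m 3≤n) (≤-trans m+n≤ (≤-reflexive (+-comm 3 o))))

m<o⇒n≤2⇒m+n≤o+1 : ∀ {m n o} → m < o → n ≤ 2 → m + n ≤ o + 1
m<o⇒n≤2⇒m+n≤o+1 {o = o} m<o n≤2 = s≤s⁻¹ (≤-trans (+-mono-≤ m<o n≤2) (≤-reflexive (+-suc o 1)))

Edges : ℕ → Set
Edges k = Fin k → Fin k → Bool

-- In the clique graph, a vertex i ∈ A outside S = SA ∪ SB has all of SA and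
-- its H-neighbours in SB as neighbours in S.
SideClosed : ∀ {k} → Edges k → ℕ → VSet k → VSet k → Set
SideClosed hE r SA SB = ∀ i → i ∉ˢ SA → ∣ SA ∣ˢ + ∣ hE i ∩ SB ∣ˢ < r

record ClosedSuperset {k} (hE : Edges k) (r : ℕ) (XA XB : VSet k) : Set where
  field
    SA SB   : VSet k
    XA⊆SA   : XA ⊆ SA
    XB⊆SB   : XB ⊆ SB
    closedA : SideClosed hE r SA SB
    closedB : SideClosed (flip hE) r SB SA
    proper  : ∃ (_∉ˢ SA) ⊎ ∃ (_∉ˢ SB)

flipClosedSuperset : ∀ {k} {hE : Edges k} {r XA XB} →
  ClosedSuperset (flip hE) r XB XA → ClosedSuperset hE r XA XB
flipClosedSuperset C = record
  { SA = SB ; SB = SA ; XA⊆SA = XB⊆SB ; XB⊆SB = XA⊆SA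
  ; closedA = closedB ; closedB = closedA ; proper = ⊎-swap proper }
  where open ClosedSuperset C

SideClosed-deficit : ∀ {k} {hE : Edges k} {r SA SB m} →
  (∀ i → i ∉ˢ SA → ∣ hE i ∩ SB ∣ˢ < m) → ∣ SA ∣ˢ + m ≤ r → SideClosed hE r SA SB
SideClosed-deficit few SA+m≤r i i∉SA = <-≤-trans (+-monoʳ-< _ (few i i∉SA)) SA+m≤r

SideClosed-insert : ∀ {k} {hE : Edges k} {d XA SB p} → p ∉ˢ XA →
  (∀ i → i ∉ˢ XA ∪ ｛ p ｝ → ∣ XA ∣ˢ + ∣ hE i ∩ SB ∣ˢ ≤ d + 1) →
  SideClosed hE (3 + d) (XA ∪ ｛ p ｝) SB
SideClosed-insert {hE = hE} {d} {XA} {SB} p∉XA budget i i∉ =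
  subst (λ s → s + ∣ hE i ∩ SB ∣ˢ < 3 + d) (sym (∣∪｛｝∣ XA p∉XA))
    (s≤s (s≤s (≤-trans (budget i i∉) (≤-reflexive (+-comm d 1)))))

∪｛｝-proper : ∀ {k d} {X : VSet k} {p} → p ∉ˢ X → ∣ X ∣ˢ ≤ d → 2 + d ≤ k → ∃ (_∉ˢ X ∪ ｛ p ｝)
∪｛｝-proper {k} {X = X} {p} p∉X ∣X∣≤d 2+d≤k =
  ∣∣<N⇒∉ (X ∪ ｛ p ｝) (subst (_< k) (sym (∣∪｛｝∣ X p∉X)) (≤-trans (s≤s (s≤s ∣X∣≤d)) 2+d≤k))

undominated-closedSuperset : ∀ {k} {hE : Edges k} {d XA XB} →
  (∀ i → i ∉ˢ XA → ∣ hE i ∩ XB ∣ˢ < ∣ XB ∣ˢ) → (∀ j → j ∉ˢ XB → ∣ flip hE j ∩ XA ∣ˢ < ∣ XA ∣ˢ) →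
  ∣ XA ∣ˢ ≤ d → ∣ XA ∣ˢ + ∣ XB ∣ˢ ≤ 3 + d → 2 + d ≤ k → ClosedSuperset hE (3 + d) XA XB
undominated-closedSuperset {hE = hE} {XA = XA} {XB} no-p no-q a≤d a+b≤ 2+d≤k = record
  { SA = XA ; SB = XB ; XA⊆SA = λ _ i∈ → i∈ ; XB⊆SB = λ _ j∈ → j∈
  ; closedA = SideClosed-deficit {hE = hE} no-p a+b≤
  ; closedB = SideClosed-deficit {hE = flip hE} no-q (≤-trans (≤-reflexive (+-comm ∣ XB ∣ˢ ∣ XA ∣ˢ)) a+b≤)
  ; proper  = inj₁ (∣∣<N⇒∉ XA (≤-trans (s≤s a≤d) (≤-trans (n≤1+n _) 2+d≤k))) }

record RegularC4Free {k} (hE : Edges k) (d : ℕ) : Set where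
  field
    regular : IsRegularBip hE d
    c4-free : C4Free hE

flipRegularC4Free : ∀ {k} {hE : Edges k} {d} → RegularC4Free hE d → RegularC4Free (flip hE) d
flipRegularC4Free H = record
  { regular = proj₂ regular , proj₁ regular
  ; c4-free = λ b b' a a' b≢b' a≢a' (ab , a'b , ab' , a'b') →
      c4-free a a' b b' a≢a' b≢b' (ab , ab' , a'b , a'b') }
  where open RegularC4Free H

module NeighbourBounds {k} {hE : Edges k} {d} (H : RegularC4Free hE d) where
  open RegularC4Free H

  common-neighbours≤1 : ∀ {i i'} → i ≢ i' → ∣ hE i ∩ hE i' ∣ˢ ≤ 1
  common-neighbours≤1 {i} {i'} i≢i' with 2 ≤? ∣ hE i ∩ hE i' ∣ˢ
  ... | no ≱2 = s≤s⁻¹ (≰⇒> ≱2)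
  ... | yes ≥2 with ∣∣≥2⇒distinct (hE i ∩ hE i') ≥2
  ...   | j , j' , j≢j' , j∈ , j'∈ = ⊥-elim (c4-free i i' j j' i≢i' j≢j'
          ( ∧-conicalˡ (hE i j) (hE i' j) j∈ , ∧-conicalˡ (hE i j') (hE i' j') j'∈
          , ∧-conicalʳ (hE i j) (hE i' j) j∈ , ∧-conicalʳ (hE i j') (hE i' j') j'∈))

  ∣N∩dominated∣≤1 : ∀ {XB p i} → XB ⊆ hE p → i ≢ p → ∣ hE i ∩ XB ∣ˢ ≤ 1
  ∣N∩dominated∣≤1 {i = i} XB⊆Np i≢p =
    ≤-trans (∣∣-mono (∩-monoʳ {X = hE i} XB⊆Np)) (common-neighbours≤1 i≢p)

  -- If i is adjacent to q, then q has at least |XA| + 1 neighbours, so |XA| < d.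
  dominator-insert-budget : ∀ {XA XB p q} → XB ⊆ hE p → ∣ XA ∣ˢ ≤ d →
    ∣ XA ∣ˢ ≤ ∣ flip hE q ∩ (XA ∪ ｛ p ｝) ∣ˢ →
    ∀ i → i ∉ˢ XA ∪ ｛ p ｝ → ∣ XA ∣ˢ + ∣ hE i ∩ (XB ∪ ｛ q ｝) ∣ˢ ≤ d + 1
  dominator-insert-budget {XA} {XB} {p} {q} XB⊆Np a≤d a≤ i i∉ with hE i q in iq
  ... | false = +-mono-≤ a≤d (≤-trans (∣∩∪｛｝∣-∉ (hE i) XB iq) (∣N∩dominated∣≤1 XB⊆Np (∉∪｛｝⇒≢ {X = XA} i i∉)))
  ... | true  = m<o⇒n≤2⇒m+n≤o+1
    (≤-<-trans a≤ (<-≤-trans (∣∩∣<∣∣ {X = flip hE q} {XA ∪ ｛ p ｝} i iq i∉) (≤-reflexive (proj₂ regular q))))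
    (≤-trans (∣∩∪｛｝∣≤ (hE i) XB q) (s≤s (∣N∩dominated∣≤1 XB⊆Np (∉∪｛｝⇒≢ {X = XA} i i∉))))

module _ {k} {hE : Edges k} {d} (H : RegularC4Free hE d) where
  open RegularC4Free H
  open NeighbourBounds H
  private module Flipped = NeighbourBounds (flipRegularC4Free H)

  small-closedSuperset : ∀ {XA XB} → ∣ XB ∣ˢ ≤ 2 → 1 ≤ d → 2 + d ≤ k → ClosedSuperset hE (3 + d) XA XB
  small-closedSuperset {XA} {XB} b≤2 1≤d 2+d≤k = record
    { SA = full ; SB = XB ; XA⊆SA = λ _ _ → refl ; XB⊆SB = λ _ j∈ → j∈
    ; closedA = λ _ ()
    ; closedB = λ j _ → s≤s (+-mono-≤ b≤2
        (≤-trans (∣∣-mono (∩-⊆ˡ {X = flip hE j} {full})) (≤-reflexive (proj₂ regular j))))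
    ; proper  = inj₂ (∣∣<N⇒∉ XB (≤-trans (s≤s b≤2) (≤-trans (+-monoʳ-≤ 2 1≤d) 2+d≤k))) }

  -- p is adjacent to XB and q, so |XB| < d; and j has at most one neighbour in
  -- XA ∪ {p} inside N(q) (no 4-cycle) and at most one outside N(q).
  adjacent-pair-budget : ∀ {XA XB p q} → p ∉ˢ XA → XB ⊆ hE p → q ∉ˢ XB → hE p q ≡ true →
    ∣ XA ∣ˢ ≤ ∣ flip hE q ∩ (XA ∪ ｛ p ｝) ∣ˢ →
    ∀ j → j ∉ˢ XB ∪ ｛ q ｝ → ∣ XB ∣ˢ + ∣ flip hE j ∩ (XA ∪ ｛ p ｝) ∣ˢ ≤ d + 1
  adjacent-pair-budget {XA} {XB} {p} {q} p∉XA XB⊆Np q∉XB pq a≤ j j∉ = m<o⇒n≤2⇒m+n≤o+1 b<d x≤2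
    where
      SA = XA ∪ ｛ p ｝
      b<d : ∣ XB ∣ˢ < d
      b<d = begin-strict
        ∣ XB ∣ˢ              ≤⟨ ∣∣-mono (λ i i∈ → ∈-∩ {X = hE p} {XB} i (XB⊆Np i i∈) i∈) ⟩
        ∣ hE p ∩ XB ∣ˢ       <⟨ ∣∩∣<∣∣ {X = hE p} {XB} q pq q∉XB ⟩
        ∣ hE p ∣ˢ            ≡⟨ proj₁ regular p ⟩
        d                    ∎
        where open ≤-Reasoning
      split : ∀ x y s → x ∧ s ≡ true → (x ∧ y) ∨ (s ∧ not y) ≡ true
      split true true  true _ = refl
      split true false true _ = refl
      inside-Nq : ∣ flip hE j ∩ flip hE q ∣ˢ ≤ 1
      inside-Nq = Flipped.common-neighbours≤1 (∉∪｛｝⇒≢ {X = XB} j j∉)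
      outside-Nq : ∣ SA ∩ ∁ (flip hE q) ∣ˢ ≤ 1
      outside-Nq = ∣∩∁∣≤1 {X = SA} {flip hE q} (∣∪｛｝∣ XA p∉XA)
                     (≤-trans a≤ (≤-reflexive (∣∩∣-comm (flip hE q) SA)))
      x≤2 : ∣ flip hE j ∩ SA ∣ˢ ≤ 2
      x≤2 = begin
        ∣ flip hE j ∩ SA ∣ˢ                                 ≤⟨ ∣∣-mono (λ i → split (hE i j) (hE i q) (SA i)) ⟩
        ∣ (flip hE j ∩ flip hE q) ∪ (SA ∩ ∁ (flip hE q)) ∣ˢ  ≤⟨ ∣∪∣≤ (flip hE j ∩ flip hE q) (SA ∩ ∁ (flip hE q)) ⟩
        ∣ flip hE j ∩ flip hE q ∣ˢ + ∣ SA ∩ ∁ (flip hE q) ∣ˢ ≤⟨ +-mono-≤ inside-Nq outside-Nq ⟩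
        2                                                   ∎
        where open ≤-Reasoning

  dominator-closedSuperset : ∀ {XA XB p} → p ∉ˢ XA → XB ⊆ hE p → ∣ XA ∣ˢ ≤ d →
    ∣ XA ∣ˢ + ∣ XB ∣ˢ ≤ 3 + d → 2 + d ≤ k →
    (∀ q → q ∉ˢ XB → ∣ flip hE q ∩ (XA ∪ ｛ p ｝) ∣ˢ < ∣ XA ∣ˢ) → ClosedSuperset hE (3 + d) XA XB
  dominator-closedSuperset {XA} {XB} {p} p∉XA XB⊆Np a≤d a+b≤ 2+d≤k no-q = record
    { SA = XA ∪ ｛ p ｝ ; SB = XB ; XA⊆SA = ⊆-∪ˡ ; XB⊆SB = λ _ j∈ → j∈
    ; closedA = SideClosed-insert {hE = hE} p∉XA λ i i∉ →
        +-mono-≤ a≤d (∣N∩dominated∣≤1 XB⊆Np (∉∪｛｝⇒≢ {X = XA} i i∉))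
    ; closedB = SideClosed-deficit {hE = flip hE} no-q (≤-trans (≤-reflexive (+-comm ∣ XB ∣ˢ ∣ XA ∣ˢ)) a+b≤)
    ; proper  = inj₁ (∪｛｝-proper p∉XA a≤d 2+d≤k) }

  dominator-pair-closedSuperset : ∀ {XA XB p q} → p ∉ˢ XA → XB ⊆ hE p → q ∉ˢ XB →
    ∣ XA ∣ˢ ≤ ∣ flip hE q ∩ (XA ∪ ｛ p ｝) ∣ˢ → ∣ XA ∣ˢ ≤ d → ∣ XB ∣ˢ ≤ d → 2 + d ≤ k →
    ClosedSuperset hE (3 + d) XA XB
  dominator-pair-closedSuperset {XA} {XB} {p} {q} p∉XA XB⊆Np q∉XB a≤ a≤d b≤d 2+d≤k = record
    { SA = XA ∪ ｛ p ｝ ; SB = XB ∪ ｛ q ｝ ; XA⊆SA = ⊆-∪ˡ ; XB⊆SB = ⊆-∪ˡ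
    ; closedA = SideClosed-insert {hE = hE} p∉XA (dominator-insert-budget XB⊆Np a≤d a≤)
    ; closedB = closedB
    ; proper  = inj₁ (∪｛｝-proper p∉XA a≤d 2+d≤k) }
    where
      closedB : SideClosed (flip hE) (3 + d) (XB ∪ ｛ q ｝) (XA ∪ ｛ p ｝)
      closedB with hE p q in pq
      ... | true  = SideClosed-insert {hE = flip hE} q∉XB (adjacent-pair-budget p∉XA XB⊆Np q∉XB pq a≤)
      ... | false = SideClosed-insert {hE = flip hE} q∉XB (Flipped.dominator-insert-budget XA⊆Nq b≤d b≤)
        where
          XA⊆Nq : XA ⊆ flip hE q
          XA⊆Nq = ∣∣≤∣∩∣⇒⊆ (≤-trans a≤ (∣∩∪｛｝∣-∉ (flip hE q) XA pq))
          b≤ : ∣ XB ∣ˢ ≤ ∣ hE p ∩ (XB ∪ ｛ q ｝) ∣ˢ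
          b≤ = ∣∣-mono (λ j j∈ → ∈-∩ {X = hE p} {XB ∪ ｛ q ｝} j (XB⊆Np j j∈) (⊆-∪ˡ {X = XB} {｛ q ｝} j j∈))

  dominated-closedSuperset : ∀ {XA XB p} → p ∉ˢ XA → XB ⊆ hE p → ∣ XA ∣ˢ ≤ d → ∣ XB ∣ˢ ≤ d →
    ∣ XA ∣ˢ + ∣ XB ∣ˢ ≤ 3 + d → 2 + d ≤ k → ClosedSuperset hE (3 + d) XA XB
  dominated-closedSuperset {XA} {XB} {p} p∉XA XB⊆Np a≤d b≤d a+b≤ 2+d≤k
    with any? (λ q → (XB q ≟ᵇ false) ×-dec (∣ XA ∣ˢ ≤? ∣ flip hE q ∩ (XA ∪ ｛ p ｝) ∣ˢ))
  ... | yes (q , q∉XB , a≤) = dominator-pair-closedSuperset p∉XA XB⊆Np q∉XB a≤ a≤d b≤d 2+d≤k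
  ... | no ∄q = dominator-closedSuperset p∉XA XB⊆Np a≤d a+b≤ 2+d≤k
                  (λ q q∉XB → ≰⇒> (λ a≤ → ∄q (q , q∉XB , a≤)))

dominator? : ∀ {k} (hE : Edges k) (XA XB : VSet k) p → Dec (p ∉ˢ XA × ∣ XB ∣ˢ ≤ ∣ hE p ∩ XB ∣ˢ)
dominator? hE XA XB p = (XA p ≟ᵇ false) ×-dec (∣ XB ∣ˢ ≤? ∣ hE p ∩ XB ∣ˢ)

large-closedSuperset : ∀ {k} {hE : Edges k} {d} → RegularC4Free hE d → ∀ {XA XB} →
  ∣ XA ∣ˢ ≤ d → ∣ XB ∣ˢ ≤ d → ∣ XA ∣ˢ + ∣ XB ∣ˢ ≤ 3 + d → 2 + d ≤ k → ClosedSuperset hE (3 + d) XA XB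
large-closedSuperset {hE = hE} H {XA} {XB} a≤d b≤d a+b≤ 2+d≤k
  with any? (dominator? hE XA XB) | any? (dominator? (flip hE) XB XA)
... | yes (p , p∉XA , b≤) | _ =
  dominated-closedSuperset H p∉XA (∣∣≤∣∩∣⇒⊆ b≤) a≤d b≤d a+b≤ 2+d≤k
... | no _ | yes (q , q∉XB , a≤) = flipClosedSuperset
  (dominated-closedSuperset (flipRegularC4Free H) q∉XB (∣∣≤∣∩∣⇒⊆ a≤) b≤d a≤d
    (≤-trans (≤-reflexive (+-comm ∣ XB ∣ˢ ∣ XA ∣ˢ)) a+b≤) 2+d≤k)
... | no ∄p | no ∄q = undominated-closedSuperset
  (λ i i∉ → ≰⇒> (λ b≤ → ∄p (i , i∉ , b≤))) (λ j j∉ → ≰⇒> (λ a≤ → ∄q (j , j∉ , a≤))) a≤d a+b≤ 2+d≤k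

closedSuperset : ∀ {k} {hE : Edges k} {d} → RegularC4Free hE d → 1 ≤ d → 2 + d ≤ k → ∀ {XA XB} →
  ∣ XA ∣ˢ + ∣ XB ∣ˢ ≤ 3 + d → ClosedSuperset hE (3 + d) XA XB
closedSuperset H 1≤d 2+d≤k {XA} {XB} a+b≤ with ∣ XB ∣ˢ ≤? 2 | ∣ XA ∣ˢ ≤? 2
... | yes b≤2 | _       = small-closedSuperset H b≤2 1≤d 2+d≤k
... | no _    | yes a≤2 = flipClosedSuperset (small-closedSuperset (flipRegularC4Free H) a≤2 1≤d 2+d≤k)
... | no b≰2  | no a≰2  = large-closedSuperset H
  (m+n≤3+o⇒m≤o (≰⇒> b≰2) a+b≤)
  (m+n≤3+o⇒m≤o (≰⇒> a≰2) (≤-trans (≤-reflexive (+-comm ∣ XB ∣ˢ ∣ XA ∣ˢ)) a+b≤))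
  a+b≤ 2+d≤k

module CliqueGraph {k} (hE : Edges k) where

  G : Graph (k + k)
  G = cliqueGraph hE

  data Side : Fin (k + k) → Set where
    inA : ∀ i → Side (i ↑ˡ k)
    inB : ∀ j → Side (k ↑ʳ j)

  side : ∀ w → Side w
  side w with splitAt k w in eq
  ... | inj₁ i = subst Side (splitAt⁻¹-↑ˡ eq) (inA i)
  ... | inj₂ j = subst Side (splitAt⁻¹-↑ʳ eq) (inB j)

  _⊎ˢ_ : VSet k → VSet k → VSet (k + k)
  (SA ⊎ˢ SB) w = [ SA , SB ]′ (splitAt k w)

  ⊎ˢ-inA : ∀ {SA SB} i → (SA ⊎ˢ SB) (i ↑ˡ k) ≡ SA i
  ⊎ˢ-inA i rewrite splitAt-↑ˡ k i k = refl

  ⊎ˢ-inB : ∀ {SA SB} j → (SA ⊎ˢ SB) (k ↑ʳ j) ≡ SB j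
  ⊎ˢ-inB j rewrite splitAt-↑ʳ k k j = refl

  ∣adj∩∣-inA : ∀ i (S : VSet (k + k)) →
    ∣ adj G (i ↑ˡ k) ∩ S ∣ˢ ≡ ∣ ∁ ｛ i ｝ ∩ (S ∘ (_↑ˡ k)) ∣ˢ + ∣ hE i ∩ (S ∘ (k ↑ʳ_)) ∣ˢ
  ∣adj∩∣-inA i S = trans (∣∣-splitAt k k _) (cong₂ _+_
    (∣∣-cong λ i' → cong (_∧ S (i' ↑ˡ k)) (adjAA i'))
    (∣∣-cong λ j → cong (_∧ S (k ↑ʳ j)) (adjAB j)))
    where
      adjAA : ∀ i' → adj G (i ↑ˡ k) (i' ↑ˡ k) ≡ neq i i'
      adjAA i' rewrite splitAt-↑ˡ k i k | splitAt-↑ˡ k i' k = refl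
      adjAB : ∀ j → adj G (i ↑ˡ k) (k ↑ʳ j) ≡ hE i j
      adjAB j rewrite splitAt-↑ˡ k i k | splitAt-↑ʳ k k j = refl

  ∣adj∩∣-inB : ∀ j (S : VSet (k + k)) →
    ∣ adj G (k ↑ʳ j) ∩ S ∣ˢ ≡ ∣ ∁ ｛ j ｝ ∩ (S ∘ (k ↑ʳ_)) ∣ˢ + ∣ flip hE j ∩ (S ∘ (_↑ˡ k)) ∣ˢ
  ∣adj∩∣-inB j S = trans (∣∣-splitAt k k _) (trans (cong₂ _+_
    (∣∣-cong λ i → cong (_∧ S (i ↑ˡ k)) (adjBA i))
    (∣∣-cong λ j' → cong (_∧ S (k ↑ʳ j')) (adjBB j')))
    (+-comm ∣ flip hE j ∩ (S ∘ (_↑ˡ k)) ∣ˢ ∣ ∁ ｛ j ｝ ∩ (S ∘ (k ↑ʳ_)) ∣ˢ))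
    where
      adjBA : ∀ i → adj G (k ↑ʳ j) (i ↑ˡ k) ≡ hE i j
      adjBA i rewrite splitAt-↑ʳ k k j | splitAt-↑ˡ k i k = refl
      adjBB : ∀ j' → adj G (k ↑ʳ j) (k ↑ʳ j') ≡ neq j j'
      adjBB j' rewrite splitAt-↑ʳ k k j | splitAt-↑ʳ k k j' = refl

  degree : ∀ {e} → IsRegularBip hE (suc e) → ∀ w → deg G w ≡ k + e
  degree {e} (regA , regB) w with side w
  ... | inA i = begin
    ∣ adj G (i ↑ˡ k) ∣ˢ                            ≡⟨ sym (∣∩full∣ (adj G (i ↑ˡ k))) ⟩
    ∣ adj G (i ↑ˡ k) ∩ full ∣ˢ                     ≡⟨ ∣adj∩∣-inA i full ⟩
    ∣ ∁ ｛ i ｝ ∩ full ∣ˢ + ∣ hE i ∩ full ∣ˢ        ≡⟨ cong₂ _+_ (∣∩full∣ (∁ ｛ i ｝)) (trans (∣∩full∣ (hE i)) (regA i)) ⟩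
    ∣ ∁ ｛ i ｝ ∣ˢ + suc e                          ≡⟨ +-suc _ e ⟩
    suc ∣ ∁ ｛ i ｝ ∣ˢ + e                          ≡⟨ cong (_+ e) (∣∁｛｝∣ i) ⟩
    k + e                                          ∎
    where open ≡-Reasoning
  ... | inB j = begin
    ∣ adj G (k ↑ʳ j) ∣ˢ                            ≡⟨ sym (∣∩full∣ (adj G (k ↑ʳ j))) ⟩
    ∣ adj G (k ↑ʳ j) ∩ full ∣ˢ                     ≡⟨ ∣adj∩∣-inB j full ⟩
    ∣ ∁ ｛ j ｝ ∩ full ∣ˢ + ∣ flip hE j ∩ full ∣ˢ   ≡⟨ cong₂ _+_ (∣∩full∣ (∁ ｛ j ｝)) (trans (∣∩full∣ (flip hE j)) (regB j)) ⟩
    ∣ ∁ ｛ j ｝ ∣ˢ + suc e                          ≡⟨ +-suc _ e ⟩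
    suc ∣ ∁ ｛ j ｝ ∣ˢ + e                          ≡⟨ cong (_+ e) (∣∁｛｝∣ j) ⟩
    k + e                                          ∎
    where open ≡-Reasoning

  ⊎ˢ-closed : ∀ {r SA SB} → SideClosed hE r SA SB → SideClosed (flip hE) r SB SA →
    IsClosed G r (SA ⊎ˢ SB)
  ⊎ˢ-closed {r} {SA} {SB} closedA closedB w w∉S with side w
  ... | inA i = begin-strict
    ∣ adj G (i ↑ˡ k) ∩ (SA ⊎ˢ SB) ∣ˢ      ≡⟨ ∣adj∩∣-inA i (SA ⊎ˢ SB) ⟩
    ∣ ∁ ｛ i ｝ ∩ ((SA ⊎ˢ SB) ∘ (_↑ˡ k)) ∣ˢ + ∣ hE i ∩ ((SA ⊎ˢ SB) ∘ (k ↑ʳ_)) ∣ˢ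
      ≡⟨ cong₂ _+_ (∣∣-cong λ i' → cong (not ⌊ i ≟ i' ⌋ ∧_) (⊎ˢ-inA i'))
                   (∣∣-cong λ j → cong (hE i j ∧_) (⊎ˢ-inB j)) ⟩
    ∣ ∁ ｛ i ｝ ∩ SA ∣ˢ + ∣ hE i ∩ SB ∣ˢ     ≤⟨ +-monoˡ-≤ _ (∣∣-mono (∩-⊆ʳ {X = ∁ ｛ i ｝} {SA})) ⟩
    ∣ SA ∣ˢ + ∣ hE i ∩ SB ∣ˢ                <⟨ closedA i (trans (sym (⊎ˢ-inA i)) w∉S) ⟩
    r                                       ∎
    where open ≤-Reasoning
  ... | inB j = begin-strict
    ∣ adj G (k ↑ʳ j) ∩ (SA ⊎ˢ SB) ∣ˢ      ≡⟨ ∣adj∩∣-inB j (SA ⊎ˢ SB) ⟩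
    ∣ ∁ ｛ j ｝ ∩ ((SA ⊎ˢ SB) ∘ (k ↑ʳ_)) ∣ˢ + ∣ flip hE j ∩ ((SA ⊎ˢ SB) ∘ (_↑ˡ k)) ∣ˢ
      ≡⟨ cong₂ _+_ (∣∣-cong λ j' → cong (not ⌊ j ≟ j' ⌋ ∧_) (⊎ˢ-inB j'))
                   (∣∣-cong λ i → cong (hE i j ∧_) (⊎ˢ-inA i)) ⟩
    ∣ ∁ ｛ j ｝ ∩ SB ∣ˢ + ∣ flip hE j ∩ SA ∣ˢ  ≤⟨ +-monoˡ-≤ _ (∣∣-mono (∩-⊆ʳ {X = ∁ ｛ j ｝} {SB})) ⟩
    ∣ SB ∣ˢ + ∣ flip hE j ∩ SA ∣ˢ             <⟨ closedB j (trans (sym (⊎ˢ-inB j)) w∉S) ⟩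
    r                                         ∎
    where open ≤-Reasoning

  ⊆-⊎ˢ : ∀ {X SA SB} → X ∘ (_↑ˡ k) ⊆ SA → X ∘ (k ↑ʳ_) ⊆ SB → X ⊆ SA ⊎ˢ SB
  ⊆-⊎ˢ XA⊆SA XB⊆SB w w∈X with side w
  ... | inA i = trans (⊎ˢ-inA i) (XA⊆SA i w∈X)
  ... | inB j = trans (⊎ˢ-inB j) (XB⊆SB j w∈X)

  small-sets-do-not-percolate : ∀ {d} → RegularC4Free hE d → 1 ≤ d → 2 + d ≤ k →
    ∀ X → ∣ X ∣ˢ ≤ 3 + d → ¬ Percolates G (3 + d) X
  small-sets-do-not-percolate H 1≤d 2+d≤k X ∣X∣≤ =
    closed⇒¬percolates (⊆-⊎ˢ XA⊆SA XB⊆SB) (⊎ˢ-closed closedA closedB) (proj₁ outside) (proj₂ outside)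
    where
      open ClosedSuperset (closedSuperset H 1≤d 2+d≤k (subst (_≤ _) (∣∣-splitAt k k X) ∣X∣≤))
      outside : ∃ (_∉ˢ SA ⊎ˢ SB)
      outside with proper
      ... | inj₁ (i , i∉SA) = i ↑ˡ k , trans (⊎ˢ-inA i) i∉SA
      ... | inj₂ (j , j∉SB) = k ↑ʳ j , trans (⊎ˢ-inB j) j∉SB

theorem2p1 : (r k : ℕ) → 4 ≤ r → 2 * (r ∸ 1) ≤ k + k →
    (hE : Fin k → Fin k → Bool) → IsRegularBip hE (r ∸ 3) → C4Free hE →
    IsMinDegree (cliqueGraph hE) (k + (r ∸ 4)) × mGreaterThan (cliqueGraph hE) r r
theorem2p1 (suc (suc (suc (suc e)))) k (s≤s (s≤s (s≤s (s≤s _)))) 2[r-1]≤2k hE regular c4-free =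
  regular⇒IsMinDegree {G = cliqueGraph hE} (degree regular) (fromℕ< 0<k ↑ˡ k) , no-small-percolating-set
  where
    open CliqueGraph hE
    d = suc e
    2+d≤k : 2 + d ≤ k
    2+d≤k = *-cancelˡ-≤ 2 (≤-trans 2[r-1]≤2k (≤-reflexive (cong (k +_) (sym (+-identityʳ k)))))
    0<k : 0 < k
    0<k = ≤-trans (s≤s z≤n) 2+d≤k
    no-small-percolating-set : mGreaterThan G (3 + d) (3 + d)
    no-small-percolating-set X percolates with suc (3 + d) ≤? ∣ X ∣ˢ
    ... | yes large = large
    ... | no ¬large = ⊥-elim (small-sets-do-not-percolate (record { regular = regular ; c4-free = c4-free })
                        (s≤s z≤n) 2+d≤k X (s≤s⁻¹ (≰⇒> ¬large)) percolates)
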